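{- Let $T$ be the group defined below. Then the subgroup $A$ is core-free in $T$; in particular $T$ acts faithfully by right multiplication on the set of right cosets $T/A$.
   Context: Let $L$ be a permutation group on a finite set $\Omega$ that is neither transitive nor semiregular. Let $\omega_1,\ldots,\omega_k$ ($k\ge 2$) be representatives of the $L$-orbits on $\Omega$, chosen so that $L_{\omega_1}\neq 1$, and let $n\ge 2$ be an integer. Let $b_1$ be the automorphism of $L_{\omega_1}^{n+1}$ given by $(x_0,x_1,\ldots,x_n)^{b_1}=(x_n,\ldots,x_1,x_0)$ and $b_2$ the automorphism of $L_{\omega_1}^n$ given by $(x_1,\ldots,x_n)^{b_2}=(x_n,\ldots,x_1)$; for $3\le i\le k$ let $\langle b_i\rangle$ be a cyclic group of order $2$. Define $A=L\times L_{\omega_1}^n$, $B_1=(L_{\omega_1}\times L_{\omega_1}^n)\rtimes\langle b_1\rangle$, $B_2=L_{\omega_2}\times(L_{\omega_1}^n\rtimes\langle b_2\rangle)$, $B_i=L_{\omega_i}\times L_{\omega_1}^n\times\langle b_i\rangle$ for $3\le i\le k$, and $C_i=L_{\omega_i}\times L_{\omega_1}^n$ for $1\le i\le k$, with $C_i$ embedded in the obvious way in both $A$ and $B_i$. Let $T=\langle A,B_1,\ldots,B_k\mid\mathcal R\rangle$, where $\mathcal R$ consists of the relations of $A,B_1,\ldots,B_k$ together with the identification of the two copies of $C_i$ in $A$ and $B_i$ for each $i$ (the fundamental group of the tree of groups with vertex groups $A,B_1,\ldots,B_k$ and edge groups $C_i$ joining $A$ to $B_i$). The groups $A,B_i,C_i$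 embed in $T$ and are identified with their images. -}

module Defs where

open import Data.Nat using (ℕ; zero; suc; _+_)
open import Data.Fin using (Fin; zero; suc)
open import Data.Fin.Permutation using (Permutation′; _⟨$⟩ʳ_; id; flip; _∘ₚ_; _≈_)
open import Data.Bool using (Bool; true; false; _xor_)
open import Data.Vec using (Vec; _∷_; []; zipWith; replicate; reverse)
open import Data.Vec.Relation.Binary.Pointwise.Inductive using (Pointwise)
open import Data.List using (List; _∷_; []; _++_)
open import Data.Product using (Σ; ∃; _×_; _,_; proj₁; proj₂)
open import Relation.Nullary using (¬_)
open import Relation.Binary.PropositionalEquality using (_≡_; refl; trans; cong)

Perm : ℕ → Set
Perm m = Permutation′ m

-- Products are read left to right (right actions):
-- σ ∘ₚ τ is "first σ, then τ", i.e. ω^(στ) = (ω^σ)^τ.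
record PermGroup (m : ℕ) : Set₁ where
  field
    _∈L     : Perm m → Set
    ∈-resp  : ∀ {π ρ} → π ≈ ρ → π ∈L → ρ ∈L
    id∈     : id ∈L
    ∘∈      : ∀ {π ρ} → π ∈L → ρ ∈L → (π ∘ₚ ρ) ∈L
    inv∈    : ∀ {π} → π ∈L → flip π ∈L

module _ {m : ℕ} (L : PermGroup m) where
  open PermGroup L

  InOrbit : Fin m → Fin m → Set
  InOrbit x y = Σ (Perm m) λ σ → σ ∈L × σ ⟨$⟩ʳ y ≡ x

  IsTransitive : Set
  IsTransitive = ∀ x y → InOrbit x y

  IsSemiregular : Set
  IsSemiregular = ∀ x (σ : Perm m) → σ ∈L → σ ⟨$⟩ʳ x ≡ x → σ ≈ id

  IsOrbitReps : {k : ℕ} → (Fin k → Fin m) → Set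
  IsOrbitReps {k} ω = (∀ x → Σ (Fin k) λ i → InOrbit x (ω i))
                    × (∀ i j → InOrbit (ω i) (ω j) → i ≡ j)

  StabNontrivial : Fin m → Set
  StabNontrivial x = Σ (Perm m) λ σ → σ ∈L × σ ⟨$⟩ʳ x ≡ x × ¬ (σ ≈ id)

-- The tree of groups and its fundamental group T, given by a presentation
-- on the elements of the vertex groups A, B_1, ..., B_k.
-- Orbit indices: Fin (2 + k'), with zero = ω₁, suc zero = ω₂, etc.
module Construction {m : ℕ} (L : PermGroup m) (k' : ℕ)
                    (ω : Fin (2 + k') → Fin m) (n : ℕ) where
  open PermGroup L

  K : ℕ
  K = 2 + k'

  LElt : Set
  LElt = Σ (Perm m) _∈L

  Stab : Fin m → Set
  Stab x = Σ (Perm m) λ σ → σ ∈L × σ ⟨$⟩ʳ x ≡ x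

  _·L_ : LElt → LElt → LElt
  (σ , p) ·L (τ , q) = σ ∘ₚ τ , ∘∈ p q

  _·S_ : ∀ {x} → Stab x → Stab x → Stab x
  (σ , p , e) ·S (τ , q , f) = σ ∘ₚ τ , ∘∈ p q , trans (cong (τ ⟨$⟩ʳ_) e) f

  1L : LElt
  1L = id , id∈

  1S : ∀ {x} → Stab x
  1S = id , id∈ , refl

  _≈S_ : ∀ {x} → Stab x → Stab x → Set
  s ≈S t = proj₁ s ≈ proj₁ t

  ω₁ : Fin m
  ω₁ = ω zero

  Pow : ℕ → Set
  Pow j = Vec (Stab ω₁) j

  _·V_ : ∀ {j} → Pow j → Pow j → Pow j
  _·V_ = zipWith _·S_

  1V : ∀ {j} → Pow j
  1V = replicate _ 1S

  _≈V_ : ∀ {j} → Pow j → Pow j → Set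
  _≈V_ = Pointwise _≈S_

  rev? : ∀ {j} → Bool → Pow j → Pow j
  rev? true  v = reverse v
  rev? false v = v

  AElt : Set
  AElt = LElt × Pow n

  _·A_ : AElt → AElt → AElt
  (g , v) ·A (h , w) = g ·L h , v ·V w

  1A : AElt
  1A = 1L , 1V

  _≈A_ : AElt → AElt → Set
  (g , v) ≈A (h , w) = (proj₁ g ≈ proj₁ h) × v ≈V w

  -- B_1 = (L_{ω₁} × L_{ω₁}^n) ⋊ ⟨b₁⟩, elements (x₀,…,xₙ) b₁^ε;
  -- B_i (i ≥ 2) = L_{ω_i} × L_{ω₁}^n × ⟨b_i⟩ with b₂ acting by reversal on
  -- L_{ω₁}^n and b_i (i ≥ 3) central.  Product in H ⋊ ⟨b⟩ (b² = 1):
  -- (h b^ε)(h' b^δ) = h (h')^{b^ε} b^{ε+δ}.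
  BElt : Fin K → Set
  BElt zero    = Pow (suc n) × Bool
  BElt (suc j) = Stab (ω (suc j)) × Pow n × Bool

  -- action of b_i on the L_{ω₁}^n factor, i ≥ 2
  actB : Fin (suc k') → Bool → Pow n → Pow n
  actB zero    ε v = rev? ε v
  actB (suc _) ε v = v

  mulB : (i : Fin K) → BElt i → BElt i → BElt i
  mulB zero    (v , ε) (w , δ) = v ·V rev? ε w , ε xor δ
  mulB (suc j) (x , v , ε) (y , w , δ) = x ·S y , v ·V actB j ε w , ε xor δ

  oneB : (i : Fin K) → BElt i
  oneB zero    = 1V , false
  oneB (suc j) = 1S , 1V , false

  eqB : (i : Fin K) → BElt i → BElt i → Set
  eqB zero    (v , ε) (w , δ) = v ≈V w × ε ≡ δ
  eqB (suc j) (x , v , ε) (y , w , δ) = x ≈S y × v ≈V w × ε ≡ δ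

  CElt : Fin K → Set
  CElt i = Stab (ω i) × Pow n

  embA : (i : Fin K) → CElt i → AElt
  embA i ((σ , p , _) , v) = (σ , p) , v

  embB : (i : Fin K) → CElt i → BElt i
  embB zero    (x , v) = (x ∷ v) , false
  embB (suc j) (x , v) = x , v , false

  data Letter : Set where
    a : AElt → Letter
    b : (i : Fin K) → BElt i → Letter

  Word : Set
  Word = List Letter

  data Rule : Word → Word → Set where
    mulA-r : ∀ x y → Rule (a x ∷ a y ∷ []) (a (x ·A y) ∷ [])
    oneA-r : Rule (a 1A ∷ []) []
    eqA-r  : ∀ x y → x ≈A y → Rule (a x ∷ []) (a y ∷ [])
    mulB-r : ∀ i x y → Rule (b i x ∷ b i y ∷ []) (b i (mulB i x y) ∷ [])
    oneB-r : ∀ i → Rule (b i (oneB i) ∷ []) []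
    eqB-r  : ∀ i x y → eqB i x y → Rule (b i x ∷ []) (b i y ∷ [])
    amal-r : ∀ i c → Rule (a (embA i c) ∷ []) (b i (embB i c) ∷ [])

  infix 4 _~_
  data _~_ : Word → Word → Set where
    rule   : ∀ {u v} → Rule u v → u ~ v
    refl~  : ∀ {u} → u ~ u
    sym~   : ∀ {u v} → u ~ v → v ~ u
    trans~ : ∀ {u v w} → u ~ v → v ~ w → u ~ w
    ctx    : ∀ p q {u v} → u ~ v → (p ++ u ++ q) ~ (p ++ v ++ q)

  -- w ∈ t A t⁻¹  (i.e. t⁻¹ w t ∈ A)
  InConjA : Word → Word → Set
  InConjA t w = Σ AElt λ x → (w ++ t) ~ (t ++ a x ∷ [])

  CoreFree : Set
  CoreFree = ∀ w → (∀ t → InConjA t w) → w ~ []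

  -- right cosets: A u = A v
  SameCoset : Word → Word → Set
  SameCoset u v = Σ AElt λ x → u ~ (a x ∷ v)

  -- T acts faithfully on T/A by right multiplication (At)·w = A(tw):
  -- only the identity fixes every coset
  FaithfulOnCosets : Set
  FaithfulOnCosets = ∀ w → (∀ t → SameCoset (t ++ w) t) → w ~ []

module Submission where

-- We build an explicit right action of T on *reduced sequences*:
-- lists [α₁, …, α_r] of points of Ω in which no α_{j+1} is the
-- representative of the orbit of α_j.  The empty sequence plays the role of
-- the coset A.  An element (g, x) of A acts through a cocycle built from a
-- transversal of the orbit representatives and the automorphisms b_i of
-- C_i; the generator b_i pushes ω_i onto a sequence, or pops it.

open import Defs
open import Data.Nat using (ℕ; _≤_; _+_; suc; zero)
open import Data.Fin using (Fin; zero; suc; _≟_)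
open import Data.Fin.Permutation using (_⟨$⟩ʳ_; _⟨$⟩ˡ_; id; flip; _∘ₚ_; _≈_; inverseˡ; inverseʳ)
open import Data.Product using (_×_; _,_; proj₁; proj₂; Σ)
open import Data.Bool using (Bool; true; false; _xor_)
open import Data.Vec using (Vec; _∷_; []; head; tail; reverse; zipWith; map; toList; _∷ʳ_)
import Data.Vec.Properties as Vecₚ
open import Data.Vec.Relation.Binary.Pointwise.Inductive as Pointwise using (Pointwise; _∷_; [])
open import Data.Vec.Relation.Unary.All as All using (All; _∷_; [])
import Data.Vec.Relation.Unary.All.Properties as Allₚ
open import Data.List using (List; _∷_; []; _++_)
import Data.List.Properties as Listₚ
import Data.List.Relation.Unary.All as ListAll
import Data.List.Relation.Unary.All.Properties as ListAllₚ
open import Data.Unit using (⊤; tt)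
open import Data.Empty using (⊥-elim)
open import Relation.Nullary using (¬_; yes; no)
open import Relation.Binary.PropositionalEquality

module _ {A : Set} where

  pointwise-∷ʳ : ∀ {R : A → A → Set} {k} {xs ys : Vec A k} {x y} →
                 Pointwise R xs ys → R x y → Pointwise R (xs ∷ʳ x) (ys ∷ʳ y)
  pointwise-∷ʳ []       r = r ∷ []
  pointwise-∷ʳ (p ∷ ps) r = p ∷ pointwise-∷ʳ ps r

  pointwise-reverse : ∀ {R : A → A → Set} {k} {xs ys : Vec A k} →
                      Pointwise R xs ys → Pointwise R (reverse xs) (reverse ys)
  pointwise-reverse [] = []
  pointwise-reverse {R} {xs = x ∷ xs} {y ∷ ys} (p ∷ ps) =
    subst₂ (Pointwise R) (sym (Vecₚ.reverse-∷ x xs)) (sym (Vecₚ.reverse-∷ y ys))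
      (pointwise-∷ʳ (pointwise-reverse ps) p)

  all-∷ʳ : ∀ {Q : A → Set} {k} {xs : Vec A k} {x} → All Q xs → Q x → All Q (xs ∷ʳ x)
  all-∷ʳ []       q = q ∷ []
  all-∷ʳ (p ∷ ps) q = p ∷ all-∷ʳ ps q

  all-reverse : ∀ {Q : A → Set} {k} {xs : Vec A k} → All Q xs → All Q (reverse xs)
  all-reverse [] = []
  all-reverse {Q} {xs = x ∷ xs} (p ∷ ps) =
    subst (All Q) (sym (Vecₚ.reverse-∷ x xs)) (all-∷ʳ (all-reverse ps) p)

  all-uncons : ∀ {Q : A → Set} {k} {xs : Vec A (suc k)} → All Q xs → Q (head xs) × All Q (tail xs)
  all-uncons {xs = _ ∷ _} (q ∷ qs) = q , qs

  zipWith-∷ʳ : ∀ (f : A → A → A) {k} (xs ys : Vec A k) x y →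
               zipWith f (xs ∷ʳ x) (ys ∷ʳ y) ≡ zipWith f xs ys ∷ʳ f x y
  zipWith-∷ʳ f []       []       x y = refl
  zipWith-∷ʳ f (u ∷ xs) (v ∷ ys) x y = cong (f u v ∷_) (zipWith-∷ʳ f xs ys x y)

  reverse-zipWith : ∀ (f : A → A → A) {k} (xs ys : Vec A k) →
                    reverse (zipWith f xs ys) ≡ zipWith f (reverse xs) (reverse ys)
  reverse-zipWith f []       []       = refl
  reverse-zipWith f (x ∷ xs) (y ∷ ys) = begin
      reverse (f x y ∷ zipWith f xs ys)
    ≡⟨ Vecₚ.reverse-∷ (f x y) (zipWith f xs ys) ⟩
      reverse (zipWith f xs ys) ∷ʳ f x y
    ≡⟨ cong (_∷ʳ f x y) (reverse-zipWith f xs ys) ⟩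
      zipWith f (reverse xs) (reverse ys) ∷ʳ f x y
    ≡⟨ zipWith-∷ʳ f (reverse xs) (reverse ys) x y ⟨
      zipWith f (reverse xs ∷ʳ x) (reverse ys ∷ʳ y)
    ≡⟨ cong₂ (zipWith f) (Vecₚ.reverse-∷ x xs) (Vecₚ.reverse-∷ y ys) ⟨
      zipWith f (reverse (x ∷ xs)) (reverse (y ∷ ys))
    ∎ where open ≡-Reasoning

-- The automorphism induced by b_i on C_i = L_{ω_i} × L_{ω₁}^n, written on
-- tuples (x₀, x₁, …, x_n) (for i = 1 the tuple lies in L_{ω₁}^{n+1}):
-- b₁ reverses the whole tuple, b₂ reverses (x₁, …, x_n) and b_i, i ≥ 3,
-- acts trivially.  Orbit index zero stands for ω₁, suc zero for ω₂.
twist : ∀ {A : Set} {k n} → Fin (2 + k) → Vec A (suc n) → Vec A (suc n)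
twist zero          e       = reverse e
twist (suc zero)    (x ∷ v) = x ∷ reverse v
twist (suc (suc _)) e       = e

module _ {A : Set} {k n : ℕ} where

  twist-zipWith : ∀ (f : A → A → A) (i : Fin (2 + k)) (e e' : Vec A (suc n)) →
                  twist i (zipWith f e e') ≡ zipWith f (twist i e) (twist i e')
  twist-zipWith f zero          e       e'        = reverse-zipWith f e e'
  twist-zipWith f (suc zero)    (x ∷ v) (x' ∷ v') = cong (f x x' ∷_) (reverse-zipWith f v v')
  twist-zipWith f (suc (suc _)) e       e'        = refl

  twist-involutive : ∀ (i : Fin (2 + k)) (e : Vec A (suc n)) → twist i (twist i e) ≡ e
  twist-involutive zero          e       = Vecₚ.reverse-involutive e
  twist-involutive (suc zero)    (x ∷ v) = cong (x ∷_) (Vecₚ.reverse-involutive v)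
  twist-involutive (suc (suc _)) e       = refl

  twist-pointwise : ∀ {R : A → A → Set} (i : Fin (2 + k)) {e e' : Vec A (suc n)} →
                    Pointwise R e e' → Pointwise R (twist i e) (twist i e')
  twist-pointwise zero          p        = pointwise-reverse p
  twist-pointwise (suc zero)    (p ∷ ps) = p ∷ pointwise-reverse ps
  twist-pointwise (suc (suc _)) p        = p

  twist-all : ∀ {Q : A → Set} (i : Fin (2 + k)) {e : Vec A (suc n)} → All Q e → All Q (twist i e)
  twist-all zero          p        = all-reverse p
  twist-all (suc zero)    (q ∷ qs) = q ∷ all-reverse qs
  twist-all (suc (suc _)) p        = p

  rotate : Vec A (suc n) → Vec A (suc n)
  rotate e = twist {k = k} zero (twist {k = k} (suc zero) e)

  toList-rotate : ∀ (x : A) (v : Vec A n) → toList (rotate (x ∷ v)) ≡ toList v ++ x ∷ []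
  toList-rotate x v = begin
      toList (reverse (x ∷ reverse v))
    ≡⟨ Vecₚ.toList-reverse (x ∷ reverse v) ⟩
      Data.List.reverse (x ∷ toList (reverse v))
    ≡⟨ Listₚ.unfold-reverse x (toList (reverse v)) ⟩
      Data.List.reverse (toList (reverse v)) ++ x ∷ []
    ≡⟨ cong (λ l → Data.List.reverse l ++ x ∷ []) (Vecₚ.toList-reverse v) ⟩
      Data.List.reverse (Data.List.reverse (toList v)) ++ x ∷ []
    ≡⟨ cong (_++ x ∷ []) (Listₚ.reverse-involutive (toList v)) ⟩
      toList v ++ x ∷ []
    ∎ where open ≡-Reasoning

module _ {m : ℕ} where

  infix 4 _≋_
  _≋_ : ∀ {k} → Vec (Perm m) k → Vec (Perm m) k → Set
  _≋_ = Pointwise _≈_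

  ≋-refl : ∀ {k} {e : Vec (Perm m) k} → e ≋ e
  ≋-refl = Pointwise.refl (λ _ → refl)

  ≋-sym : ∀ {k} {e e' : Vec (Perm m) k} → e ≋ e' → e' ≋ e
  ≋-sym = Pointwise.sym (λ p x → sym (p x))

  ≋-trans : ∀ {k} {e e' e'' : Vec (Perm m) k} → e ≋ e' → e' ≋ e'' → e ≋ e''
  ≋-trans = Pointwise.trans (λ p q x → trans (p x) (q x))

  ≡⇒≋ : ∀ {k} {e e' : Vec (Perm m) k} → e ≡ e' → e ≋ e'
  ≡⇒≋ refl = ≋-refl

  Trivial : ∀ {k} → Vec (Perm m) k → Set
  Trivial = All (_≈ id)

  perm-injective : ∀ (π : Perm m) {x y} → π ⟨$⟩ʳ x ≡ π ⟨$⟩ʳ y → x ≡ y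
  perm-injective π {x} {y} e = trans (sym (inverseˡ π)) (trans (cong (π ⟨$⟩ˡ_) e) (inverseˡ π))

  inverse-of-trivial : ∀ (π : Perm m) → π ≈ id → ∀ y → π ⟨$⟩ˡ y ≡ y
  inverse-of-trivial π q y = trans (sym (q (π ⟨$⟩ˡ y))) (inverseʳ π)

module CosetAction {m : ℕ} (L : PermGroup m) (k' : ℕ) (ω : Fin (2 + k') → Fin m)
                   (reps : IsOrbitReps L ω) (n : ℕ) where
  open PermGroup L
  open Construction L k' ω n

  -- Tuples (g, x₁, …, x_n) of permutations; the vertex groups A and B_i
  -- will act on sequences through such tuples.
  Tuple : Set
  Tuple = Vec (Perm m) (suc n)

  _·T_ : ∀ {k} → Vec (Perm m) k → Vec (Perm m) k → Vec (Perm m) k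
  _·T_ = zipWith _∘ₚ_

  Fixes : Fin K → Perm m → Set
  Fixes i π = π ⟨$⟩ʳ ω i ≡ ω i

  orbitOf : Fin m → Fin K
  orbitOf α = proj₁ (proj₁ reps α)

  inRepOrbit : ∀ α → InOrbit L α (ω (orbitOf α))
  inRepOrbit α = proj₂ (proj₁ reps α)

  orbitOf-invariant : ∀ {g} → g ∈L → ∀ α → orbitOf (g ⟨$⟩ʳ α) ≡ orbitOf α
  orbitOf-invariant {g} g∈ α with inRepOrbit α | inRepOrbit (g ⟨$⟩ʳ α)
  ... | (σ₁ , σ₁∈ , e₁) | (σ₂ , σ₂∈ , e₂) =
    proj₂ reps (orbitOf (g ⟨$⟩ʳ α)) (orbitOf α)
      (σ₁ ∘ₚ g ∘ₚ flip σ₂ , ∘∈ σ₁∈ (∘∈ g∈ (inv∈ σ₂∈)) , moves)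
    where
    moves : σ₂ ⟨$⟩ˡ (g ⟨$⟩ʳ (σ₁ ⟨$⟩ʳ ω (orbitOf α))) ≡ ω (orbitOf (g ⟨$⟩ʳ α))
    moves = trans (cong (λ z → σ₂ ⟨$⟩ˡ (g ⟨$⟩ʳ z)) e₁)
                  (trans (cong (σ₂ ⟨$⟩ˡ_) (sym e₂)) (inverseˡ σ₂))

  orbitOf-rep : ∀ i → orbitOf (ω i) ≡ i
  orbitOf-rep i = sym (proj₂ reps i (orbitOf (ω i)) (inRepOrbit (ω i)))

  rep-injective : ∀ {i j} → ω i ≡ ω j → i ≡ j
  rep-injective {i} {j} e = proj₂ reps i j (id , id∈ , sym e)

  carry : Fin m → Perm m
  carry α with α ≟ ω (orbitOf α)
  ... | yes _ = id
  ... | no _  = proj₁ (inRepOrbit α)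

  carry∈L : ∀ α → carry α ∈L
  carry∈L α with α ≟ ω (orbitOf α)
  ... | yes _ = id∈
  ... | no _  = proj₁ (proj₂ (inRepOrbit α))

  carry-maps : ∀ α → carry α ⟨$⟩ʳ ω (orbitOf α) ≡ α
  carry-maps α with α ≟ ω (orbitOf α)
  ... | yes e = sym e
  ... | no _  = proj₂ (proj₂ (inRepOrbit α))

  carry⁻¹-maps : ∀ α → carry α ⟨$⟩ˡ α ≡ ω (orbitOf α)
  carry⁻¹-maps α = trans (cong (carry α ⟨$⟩ˡ_) (sym (carry-maps α))) (inverseˡ (carry α))

  carry-rep : ∀ i → carry (ω i) ≈ id
  carry-rep i with ω i ≟ ω (orbitOf (ω i))
  ... | yes _ = λ _ → refl
  ... | no ne = ⊥-elim (ne (cong ω (sym (orbitOf-rep i))))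

  -- Moving a tuple (g, x)
  -- past the point α replaces g by carry α · g · carry (α^g)⁻¹, which lies in
  -- L_{ω_{orbitOf α}}, and then applies the twist of that orbit.

  Seq : Set
  Seq = List (Fin m)

  rebase : Fin m → Tuple → Tuple
  rebase α (g ∷ v) = (carry α ∘ₚ g ∘ₚ flip (carry (g ⟨$⟩ʳ α))) ∷ v

  descend : Fin m → Tuple → Tuple
  descend α e = twist (orbitOf α) (rebase α e)

  act : Seq → Tuple → Seq
  act []      e = []
  act (α ∷ r) e = (head e ⟨$⟩ʳ α) ∷ act r (descend α e)

  InL : ∀ {k} → Vec (Perm m) k → Set
  InL = All _∈L

  rebase-cong : ∀ α {e e'} → e ≋ e' → rebase α e ≋ rebase α e'
  rebase-cong α {g ∷ v} {g' ∷ v'} (q ∷ qs) = heads ∷ qs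
    where
    heads : (carry α ∘ₚ g ∘ₚ flip (carry (g ⟨$⟩ʳ α))) ≈ (carry α ∘ₚ g' ∘ₚ flip (carry (g' ⟨$⟩ʳ α)))
    heads x = trans (cong (λ z → carry z ⟨$⟩ˡ (g ⟨$⟩ʳ (carry α ⟨$⟩ʳ x))) (q α))
                    (cong (carry (g' ⟨$⟩ʳ α) ⟨$⟩ˡ_) (q _))

  act-cong : ∀ p {e e'} → e ≋ e' → act p e ≡ act p e'
  act-cong []      q = refl
  act-cong (α ∷ r) {g ∷ v} {g' ∷ v'} q@(q₀ ∷ _) =
    cong₂ _∷_ (q₀ α) (act-cong r (twist-pointwise (orbitOf α) (rebase-cong α {g ∷ v} {g' ∷ v'} q)))

  rebase-trivial : ∀ α {e} → Trivial e → Trivial (rebase α e)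
  rebase-trivial α {g ∷ v} (q ∷ qs) = head-trivial ∷ qs
    where
    head-trivial : (carry α ∘ₚ g ∘ₚ flip (carry (g ⟨$⟩ʳ α))) ≈ id
    head-trivial x = trans (cong (λ z → carry z ⟨$⟩ˡ (g ⟨$⟩ʳ (carry α ⟨$⟩ʳ x))) (q α))
                           (trans (cong (carry α ⟨$⟩ˡ_) (q _)) (inverseˡ (carry α)))

  act-trivial : ∀ p {e} → Trivial e → act p e ≡ p
  act-trivial []      _ = refl
  act-trivial (α ∷ r) {e} t@(q ∷ _) =
    cong₂ _∷_ (q α) (act-trivial r (twist-all (orbitOf α) (rebase-trivial α {e} t)))

  descend-InL : ∀ α {e} → InL e → InL (descend α e)
  descend-InL α {g ∷ v} (g∈ ∷ v∈) =
    twist-all (orbitOf α) (∘∈ (carry∈L α) (∘∈ g∈ (inv∈ (carry∈L (g ⟨$⟩ʳ α)))) ∷ v∈)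

  rebase-compose : ∀ α (e e' : Tuple) → rebase α e ·T rebase (head e ⟨$⟩ʳ α) e' ≋ rebase α (e ·T e')
  rebase-compose α (g ∷ v) (g' ∷ v') = cancel ∷ ≋-refl
    where
    cancel : ((carry α ∘ₚ g ∘ₚ flip (carry (g ⟨$⟩ʳ α)))
               ∘ₚ (carry (g ⟨$⟩ʳ α) ∘ₚ g' ∘ₚ flip (carry (g' ⟨$⟩ʳ (g ⟨$⟩ʳ α)))))
             ≈ (carry α ∘ₚ (g ∘ₚ g') ∘ₚ flip (carry (g' ⟨$⟩ʳ (g ⟨$⟩ʳ α))))
    cancel x = cong (λ z → carry (g' ⟨$⟩ʳ (g ⟨$⟩ʳ α)) ⟨$⟩ˡ (g' ⟨$⟩ʳ z)) (inverseʳ (carry (g ⟨$⟩ʳ α)))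

  descend-compose : ∀ α (e e' : Tuple) → head e ∈L →
                    descend α e ·T descend (head e ⟨$⟩ʳ α) e' ≋ descend α (e ·T e')
  descend-compose α e e' g∈ = ≋-trans (≡⇒≋ same-twist) (twist-pointwise i (rebase-compose α e e'))
    where
    i : Fin K
    i = orbitOf α
    same-twist : descend α e ·T descend (head e ⟨$⟩ʳ α) e'
                 ≡ twist i (rebase α e ·T rebase (head e ⟨$⟩ʳ α) e')
    same-twist = trans (cong (λ j → twist i (rebase α e) ·T twist j (rebase (head e ⟨$⟩ʳ α) e'))
                             (orbitOf-invariant g∈ α))
                       (sym (twist-zipWith _∘ₚ_ i _ _))

  act-compose : ∀ p {e e'} → InL e → InL e' → act (act p e) e' ≡ act p (e ·T e')
  act-compose []      _ _ = refl
  act-compose (α ∷ r) {e@(g ∷ _)} {e'@(g' ∷ _)} e∈ e'∈ =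
    cong ((g' ⟨$⟩ʳ (g ⟨$⟩ʳ α)) ∷_)
      (trans (act-compose r (descend-InL α e∈) (descend-InL (g ⟨$⟩ʳ α) e'∈))
             (act-cong r (descend-compose α e e' (All.head e∈))))

  InC : Fin K → Tuple → Set
  InC i e = Fixes i (head e) × All (Fixes zero) (tail e)

  InA : Tuple → Set
  InA e = InL e × All (Fixes zero) (tail e)

  twist-InC : ∀ i c → InC i c → InC i (twist i c)
  twist-InC zero          (c₀ ∷ v) (f , fs) = all-uncons (all-reverse {xs = c₀ ∷ v} (f ∷ fs))
  twist-InC (suc zero)    (c₀ ∷ v) (f , fs) = f , all-reverse fs
  twist-InC (suc (suc _)) (c₀ ∷ v) (f , fs) = f , fs

  rebase-fixes : ∀ α {e} → head e ∈L → Fixes (orbitOf α) (head (rebase α e))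
  rebase-fixes α {g ∷ v} g∈ =
    trans (cong (λ z → carry (g ⟨$⟩ʳ α) ⟨$⟩ˡ (g ⟨$⟩ʳ z)) (carry-maps α))
          (trans (carry⁻¹-maps (g ⟨$⟩ʳ α)) (cong ω (orbitOf-invariant g∈ α)))

  descend-InA : ∀ α {e} → InA e → InC (orbitOf α) (descend α e) × InA (descend α e)
  descend-InA α {e@(g ∷ v)} (e∈ , fs) =
    c∈ , descend-InL α e∈ , proj₂ c∈
    where
    c∈ : InC (orbitOf α) (descend α e)
    c∈ = twist-InC (orbitOf α) (rebase α e) (rebase-fixes α {e} (All.head e∈) , fs)

  MayFollow : Fin m → Seq → Set
  MayFollow α []      = ⊤
  MayFollow α (β ∷ _) = ¬ (β ≡ ω (orbitOf α))

  Reduced : Seq → Set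
  Reduced []      = ⊤
  Reduced (α ∷ r) = MayFollow α r × Reduced r

  act-Reduced : ∀ p e → InA e → Reduced p → Reduced (act p e)
  act-Reduced []          e           _ _              = tt
  act-Reduced (α ∷ [])    e           _ _              = tt , tt
  act-Reduced (α ∷ β ∷ r) e@(g ∷ v) e∈A (follows , red) =
    follows′ , act-Reduced (β ∷ r) (descend α e) (proj₂ (descend-InA α e∈A)) red
    where
    follows′ : ¬ (head (descend α e) ⟨$⟩ʳ β ≡ ω (orbitOf (g ⟨$⟩ʳ α)))
    follows′ eq = follows (perm-injective (head (descend α e))
      (trans eq (trans (cong ω (orbitOf-invariant (All.head (proj₁ e∈A)) α))
                       (sym (proj₁ (proj₁ (descend-InA α e∈A)))))))

  toggle : Fin K → Seq → Seq
  toggle i []      = ω i ∷ []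
  toggle i (α ∷ r) with α ≟ ω i
  ... | yes _ = r
  ... | no _  = ω i ∷ α ∷ r

  toggle-pop : ∀ i α r → α ≡ ω i → toggle i (α ∷ r) ≡ r
  toggle-pop i α r e with α ≟ ω i
  ... | yes _ = refl
  ... | no ne = ⊥-elim (ne e)

  toggle-push : ∀ i α r → ¬ (α ≡ ω i) → toggle i (α ∷ r) ≡ ω i ∷ α ∷ r
  toggle-push i α r ne with α ≟ ω i
  ... | yes e = ⊥-elim (ne e)
  ... | no _  = refl

  toggle-Reduced : ∀ i p → Reduced p → Reduced (toggle i p)
  toggle-Reduced i []      _ = tt , tt
  toggle-Reduced i (α ∷ r) red with α ≟ ω i
  ... | yes _ = proj₂ red
  ... | no ne = (λ e → ne (trans e (cong ω (orbitOf-rep i)))) , red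

  toggle-involutive : ∀ i p → Reduced p → toggle i (toggle i p) ≡ p
  toggle-involutive i []      _ = toggle-pop i (ω i) [] refl
  toggle-involutive i (α ∷ r) red with α ≟ ω i
  toggle-involutive i (α ∷ [])    _             | yes refl = refl
  toggle-involutive i (α ∷ β ∷ r) (follows , _) | yes refl =
    toggle-push i β r (λ e → follows (trans e (cong ω (sym (orbitOf-rep i)))))
  ... | no _ = toggle-pop i (ω i) (α ∷ r) refl

  descend-rep : ∀ i e → Fixes i (head e) → descend (ω i) e ≋ twist i e
  descend-rep i e@(g ∷ v) f =
    ≋-trans (≡⇒≋ (cong (λ j → twist j (rebase (ω i) e)) (orbitOf-rep i)))
            (twist-pointwise i (unchanged ∷ ≋-refl))
    where
    unchanged : (carry (ω i) ∘ₚ g ∘ₚ flip (carry (g ⟨$⟩ʳ ω i))) ≈ g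
    unchanged x = trans (cong (λ z → carry z ⟨$⟩ˡ (g ⟨$⟩ʳ (carry (ω i) ⟨$⟩ʳ x))) f)
                  (trans (inverse-of-trivial (carry (ω i)) (carry-rep i) _)
                         (cong (g ⟨$⟩ʳ_) (carry-rep i x)))

  -- the relation b_i c = c^{b_i} b_i for c ∈ C_i, read as an identity of actions
  toggle-act : ∀ i p c → InC i c → act (toggle i p) c ≡ toggle i (act p (twist i c))
  toggle-act i []      (c₀ ∷ v) (f , _) = cong (_∷ []) f
  toggle-act i (α ∷ r) c c∈ with α ≟ ω i | twist-InC i c c∈
  ... | yes refl | f′ , _ = sym (begin
      toggle i (act (ω i ∷ r) (twist i c))
    ≡⟨ toggle-pop i _ _ f′ ⟩
      act r (descend (ω i) (twist i c))
    ≡⟨ act-cong r (≋-trans (descend-rep i (twist i c) f′) (≡⇒≋ (twist-involutive i c))) ⟩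
      act r c
    ∎) where open ≡-Reasoning
  ... | no ne | f′ , _ = begin
      act (ω i ∷ α ∷ r) c
    ≡⟨ cong₂ _∷_ (proj₁ c∈) (act-cong (α ∷ r) (descend-rep i c (proj₁ c∈))) ⟩
      ω i ∷ act (α ∷ r) (twist i c)
    ≡⟨ toggle-push i _ _ moved ⟨
      toggle i (act (α ∷ r) (twist i c))
    ∎
    where
    open ≡-Reasoning
    moved : ¬ (head (twist i c) ⟨$⟩ʳ α ≡ ω i)
    moved e = ne (perm-injective (head (twist i c)) (trans e (sym f′)))

  perms : ∀ {x k} → Vec (Stab x) k → Vec (Perm m) k
  perms = map proj₁

  perms-InL : ∀ {x k} (v : Vec (Stab x) k) → InL (perms v)
  perms-InL v = Allₚ.map⁺ (All.universal (λ s → proj₁ (proj₂ s)) v)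

  perms-fix : ∀ {x k} (v : Vec (Stab x) k) → All (λ π → π ⟨$⟩ʳ x ≡ x) (perms v)
  perms-fix v = Allₚ.map⁺ (All.universal (λ s → proj₂ (proj₂ s)) v)

  perms-mul : ∀ {k} (v w : Pow k) → perms (v ·V w) ≡ perms v ·T perms w
  perms-mul []      []      = refl
  perms-mul (x ∷ v) (y ∷ w) = cong (_ ∷_) (perms-mul v w)

  perms-cong : ∀ {k} {v w : Pow k} → v ≈V w → perms v ≋ perms w
  perms-cong = Pointwise.map⁺ (λ p → p)

  perms-one : ∀ k → Trivial (perms (1V {k}))
  perms-one zero    = []
  perms-one (suc k) = (λ _ → refl) ∷ perms-one k

  tupleA : AElt → Tuple
  tupleA ((g , _) , v) = g ∷ perms v

  tupleB : (i : Fin K) → BElt i → Tuple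
  tupleB zero    (u , _)     = perms u
  tupleB (suc j) (y , v , _) = proj₁ y ∷ perms v

  flipsB : (i : Fin K) → BElt i → Bool
  flipsB zero    (_ , ε)     = ε
  flipsB (suc j) (_ , _ , ε) = ε

  toggleIf : Fin K → Bool → Seq → Seq
  toggleIf i true  p = toggle i p
  toggleIf i false p = p

  twistIf : Fin K → Bool → Tuple → Tuple
  twistIf i true  e = twist i e
  twistIf i false e = e

  actLetter : Seq → Letter → Seq
  actLetter p (a x)   = act p (tupleA x)
  actLetter p (b i x) = toggleIf i (flipsB i x) (act p (tupleB i x))

  actWord : Seq → Word → Seq
  actWord p []      = p
  actWord p (ℓ ∷ w) = actWord (actLetter p ℓ) w

  actWord-++ : ∀ p u v → actWord p (u ++ v) ≡ actWord (actWord p u) v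
  actWord-++ p []      v = refl
  actWord-++ p (ℓ ∷ u) v = actWord-++ (actLetter p ℓ) u v

  tupleA-InA : ∀ x → InA (tupleA x)
  tupleA-InA ((g , g∈) , v) = (g∈ ∷ perms-InL v) , perms-fix v

  tupleB-InL : ∀ i x → InL (tupleB i x)
  tupleB-InL zero    (u , _)               = perms-InL u
  tupleB-InL (suc j) ((y , y∈ , _) , v , _) = y∈ ∷ perms-InL v

  tupleB-InC : ∀ i x → InC i (tupleB i x)
  tupleB-InC zero    (u , _)                 = all-uncons (perms-fix u)
  tupleB-InC (suc j) ((y , _ , fy) , v , _) = fy , perms-fix v

  tupleB-InA : ∀ i x → InA (tupleB i x)
  tupleB-InA i x = tupleB-InL i x , proj₂ (tupleB-InC i x)

  actLetter-Reduced : ∀ p ℓ → Reduced p → Reduced (actLetter p ℓ)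
  actLetter-Reduced p (a x) red = act-Reduced p _ (tupleA-InA x) red
  actLetter-Reduced p (b i x) red with flipsB i x
  ... | true  = toggle-Reduced i _ (act-Reduced p _ (tupleB-InA i x) red)
  ... | false = act-Reduced p _ (tupleB-InA i x) red

  actWord-Reduced : ∀ p w → Reduced p → Reduced (actWord p w)
  actWord-Reduced p []      red = red
  actWord-Reduced p (ℓ ∷ w) red = actWord-Reduced (actLetter p ℓ) w (actLetter-Reduced p ℓ red)

  twistIf-InL : ∀ i ε {e} → InL e → InL (twistIf i ε e)
  twistIf-InL i true  e∈ = twist-all i e∈
  twistIf-InL i false e∈ = e∈

  toggleIf-act : ∀ i ε q c → InC i c → act (toggleIf i ε q) c ≡ toggleIf i ε (act q (twistIf i ε c))
  toggleIf-act i true  q c c∈ = toggle-act i q c c∈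
  toggleIf-act i false q c c∈ = refl

  toggleIf-xor : ∀ i ε δ p → Reduced p → toggleIf i δ (toggleIf i ε p) ≡ toggleIf i (ε xor δ) p
  toggleIf-xor i false false p red = refl
  toggleIf-xor i false true  p red = refl
  toggleIf-xor i true  false p red = refl
  toggleIf-xor i true  true  p red = toggle-involutive i p red

  tupleB-mul : ∀ i x y → tupleB i (mulB i x y) ≡ tupleB i x ·T twistIf i (flipsB i x) (tupleB i y)
  tupleB-mul zero          (v , false)     (w , _)     = perms-mul v w
  tupleB-mul zero          (v , true)      (w , _)     =
    trans (perms-mul v (reverse w)) (cong (perms v ·T_) (Vecₚ.map-reverse proj₁ w))
  tupleB-mul (suc zero)    (_ , v , false) (_ , w , _) = cong (_ ∷_) (perms-mul v w)
  tupleB-mul (suc zero)    (_ , v , true)  (_ , w , _) =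
    cong (_ ∷_) (trans (perms-mul v (reverse w)) (cong (perms v ·T_) (Vecₚ.map-reverse proj₁ w)))
  tupleB-mul (suc (suc _)) (_ , v , false) (_ , w , _) = cong (_ ∷_) (perms-mul v w)
  tupleB-mul (suc (suc _)) (_ , v , true)  (_ , w , _) = cong (_ ∷_) (perms-mul v w)

  flipsB-mul : ∀ i x y → flipsB i (mulB i x y) ≡ flipsB i x xor flipsB i y
  flipsB-mul zero    _ _ = refl
  flipsB-mul (suc _) _ _ = refl

  mulB-sound : ∀ i x y p → Reduced p → actWord p (b i x ∷ b i y ∷ []) ≡ actWord p (b i (mulB i x y) ∷ [])
  mulB-sound i x y p red = begin
      toggleIf i δ (act (toggleIf i ε (act p (tupleB i x))) (tupleB i y))
    ≡⟨ cong (toggleIf i δ) (toggleIf-act i ε _ (tupleB i y) (tupleB-InC i y)) ⟩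
      toggleIf i δ (toggleIf i ε (act (act p (tupleB i x)) (twistIf i ε (tupleB i y))))
    ≡⟨ cong (λ q → toggleIf i δ (toggleIf i ε q))
            (act-compose p (tupleB-InL i x) (twistIf-InL i ε (tupleB-InL i y))) ⟩
      toggleIf i δ (toggleIf i ε (act p (tupleB i x ·T twistIf i ε (tupleB i y))))
    ≡⟨ cong (λ e → toggleIf i δ (toggleIf i ε (act p e))) (tupleB-mul i x y) ⟨
      toggleIf i δ (toggleIf i ε (act p (tupleB i xy)))
    ≡⟨ toggleIf-xor i ε δ _ (act-Reduced p _ (tupleB-InA i xy) red) ⟩
      toggleIf i (ε xor δ) (act p (tupleB i xy))
    ≡⟨ cong (λ ζ → toggleIf i ζ (act p (tupleB i xy))) (flipsB-mul i x y) ⟨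
      toggleIf i (flipsB i xy) (act p (tupleB i xy))
    ∎
    where
    open ≡-Reasoning
    ε δ : Bool
    ε = flipsB i x
    δ = flipsB i y
    xy : BElt i
    xy = mulB i x y

  mulA-sound : ∀ x y p → act (act p (tupleA x)) (tupleA y) ≡ act p (tupleA (x ·A y))
  mulA-sound x@((g , _) , v) y@((g' , _) , w) p =
    trans (act-compose p (proj₁ (tupleA-InA x)) (proj₁ (tupleA-InA y)))
          (cong (λ u → act p ((g ∘ₚ g') ∷ u)) (sym (perms-mul v w)))

  tupleB-one : ∀ i → Trivial (tupleB i (oneB i))
  tupleB-one zero    = perms-one (suc n)
  tupleB-one (suc _) = (λ _ → refl) ∷ perms-one n

  tupleB-cong : ∀ i x y → eqB i x y → tupleB i x ≋ tupleB i y × flipsB i x ≡ flipsB i y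
  tupleB-cong zero    _ _ (ev , ef)      = perms-cong ev , ef
  tupleB-cong (suc _) _ _ (ex , ev , ef) = (ex ∷ perms-cong ev) , ef

  rule-sound : ∀ {u v} → Rule u v → ∀ p → Reduced p → actWord p u ≡ actWord p v
  rule-sound (mulA-r x y)  p _   = mulA-sound x y p
  rule-sound oneA-r        p _   = act-trivial p ((λ _ → refl) ∷ perms-one n)
  rule-sound (eqA-r ((g , _) , v) ((g' , _) , w) (eg , ev)) p _ = act-cong p (eg ∷ perms-cong ev)
  rule-sound (mulB-r i x y) p red = mulB-sound i x y p red
  rule-sound (oneB-r zero)    p _ = act-trivial p (tupleB-one zero)
  rule-sound (oneB-r (suc j)) p _ = act-trivial p (tupleB-one (suc j))
  rule-sound (eqB-r i x y x≈y) p _ =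
    cong₂ (toggleIf i) (proj₂ (tupleB-cong i x y x≈y)) (act-cong p (proj₁ (tupleB-cong i x y x≈y)))
  rule-sound (amal-r zero    _) p _ = refl
  rule-sound (amal-r (suc _) _) p _ = refl

  sound : ∀ {u v} → u ~ v → ∀ p → Reduced p → actWord p u ≡ actWord p v
  sound (rule r)       p red = rule-sound r p red
  sound refl~          p red = refl
  sound (sym~ e)       p red = sym (sound e p red)
  sound (trans~ e e')  p red = trans (sound e p red) (sound e' p red)
  sound (ctx P Q {u} {v} e) p red = begin
      actWord p (P ++ u ++ Q)
    ≡⟨ actWord-++ p P (u ++ Q) ⟩
      actWord (actWord p P) (u ++ Q)
    ≡⟨ actWord-++ (actWord p P) u Q ⟩
      actWord (actWord (actWord p P) u) Q
    ≡⟨ cong (λ q → actWord q Q) (sound e (actWord p P) (actWord-Reduced p P red)) ⟩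
      actWord (actWord (actWord p P) v) Q
    ≡⟨ actWord-++ (actWord p P) v Q ⟨
      actWord (actWord p P) (v ++ Q)
    ≡⟨ actWord-++ p P (v ++ Q) ⟨
      actWord p (P ++ v ++ Q)
    ∎ where open ≡-Reasoning

  generatorB : (i : Fin K) → BElt i
  generatorB zero    = 1V , true
  generatorB (suc j) = 1S , 1V , true

  generatorB-acts : ∀ i p → actLetter p (b i (generatorB i)) ≡ toggle i p
  generatorB-acts zero    p = cong (toggle zero) (act-trivial p (tupleB-one zero))
  generatorB-acts (suc j) p = cong (toggle (suc j)) (act-trivial p (tupleB-one (suc j)))

  carryA carryA⁻¹ : Fin m → AElt
  carryA   α = (carry α , carry∈L α) , 1V
  carryA⁻¹ α = (flip (carry α) , inv∈ (carry∈L α)) , 1V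

  act-headOnly : ∀ β r π → (carry β ∘ₚ π ∘ₚ flip (carry (π ⟨$⟩ʳ β))) ≈ id →
                 act (β ∷ r) (π ∷ perms (1V {n})) ≡ (π ⟨$⟩ʳ β) ∷ r
  act-headOnly β r π q = cong (_ ∷_) (act-trivial r (twist-all (orbitOf β) (q ∷ perms-one n)))

  carryA-acts : ∀ α r → act (ω (orbitOf α) ∷ r) (tupleA (carryA α)) ≡ α ∷ r
  carryA-acts α r =
    trans (act-headOnly (ω (orbitOf α)) r (carry α) rebased-trivial) (cong (_∷ r) (carry-maps α))
    where
    rebased-trivial : (carry (ω (orbitOf α)) ∘ₚ carry α ∘ₚ flip (carry (carry α ⟨$⟩ʳ ω (orbitOf α)))) ≈ id
    rebased-trivial x =
      trans (cong (λ z → carry z ⟨$⟩ˡ (carry α ⟨$⟩ʳ (carry (ω (orbitOf α)) ⟨$⟩ʳ x))) (carry-maps α))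
            (trans (cong (λ z → carry α ⟨$⟩ˡ (carry α ⟨$⟩ʳ z)) (carry-rep (orbitOf α) x)) (inverseˡ (carry α)))

  carryA⁻¹-acts : ∀ α r → act (α ∷ r) (tupleA (carryA⁻¹ α)) ≡ ω (orbitOf α) ∷ r
  carryA⁻¹-acts α r =
    trans (act-headOnly α r (flip (carry α)) rebased-trivial) (cong (_∷ r) (carry⁻¹-maps α))
    where
    rebased-trivial : (carry α ∘ₚ flip (carry α) ∘ₚ flip (carry (carry α ⟨$⟩ˡ α))) ≈ id
    rebased-trivial x =
      trans (cong (λ z → carry z ⟨$⟩ˡ (carry α ⟨$⟩ˡ (carry α ⟨$⟩ʳ x))) (carry⁻¹-maps α))
            (trans (cong (carry (ω (orbitOf α)) ⟨$⟩ˡ_) (inverseˡ (carry α)))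
                   (inverse-of-trivial (carry (ω (orbitOf α))) (carry-rep (orbitOf α)) x))

  reach : ∀ q → Reduced q → Σ Word (λ t → actWord [] t ≡ q)
  reach []      _             = [] , refl
  reach (α ∷ r) (follows , red) with reach r red
  ... | t , t↦r = t ++ b i (generatorB i) ∷ a (carryA α) ∷ [] , (begin
      actWord [] (t ++ b i (generatorB i) ∷ a (carryA α) ∷ [])
    ≡⟨ actWord-++ [] t _ ⟩
      act (actLetter (actWord [] t) (b i (generatorB i))) (tupleA (carryA α))
    ≡⟨ cong (λ p → act (actLetter p (b i (generatorB i))) (tupleA (carryA α))) t↦r ⟩
      act (actLetter r (b i (generatorB i))) (tupleA (carryA α))
    ≡⟨ cong (λ p → act p (tupleA (carryA α))) (generatorB-acts i r) ⟩
      act (toggle i r) (tupleA (carryA α))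
    ≡⟨ cong (λ p → act p (tupleA (carryA α))) (pushed r follows) ⟩
      act (ω i ∷ r) (tupleA (carryA α))
    ≡⟨ carryA-acts α r ⟩
      α ∷ r
    ∎)
    where
    open ≡-Reasoning
    i : Fin K
    i = orbitOf α
    pushed : ∀ r → MayFollow α r → toggle i r ≡ ω i ∷ r
    pushed []      _  = refl
    pushed (β ∷ r) ne = toggle-push i β r ne

  coreach : ∀ q → Reduced q → Σ Word (λ s → actWord q s ≡ [])
  coreach []      _       = [] , refl
  coreach (α ∷ r) (_ , red) with coreach r red
  ... | s , r↦[] = a (carryA⁻¹ α) ∷ b i (generatorB i) ∷ s , (begin
      actWord (actLetter (act (α ∷ r) (tupleA (carryA⁻¹ α))) (b i (generatorB i))) s
    ≡⟨ cong (λ p → actWord (actLetter p (b i (generatorB i))) s) (carryA⁻¹-acts α r) ⟩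
      actWord (actLetter (ω i ∷ r) (b i (generatorB i))) s
    ≡⟨ cong (λ p → actWord p s) (generatorB-acts i (ω i ∷ r)) ⟩
      actWord (toggle i (ω i ∷ r)) s
    ≡⟨ cong (λ p → actWord p s) (toggle-pop i (ω i) r refl) ⟩
      actWord r s
    ≡⟨ r↦[] ⟩
      []
    ∎)
    where
    open ≡-Reasoning
    i : Fin K
    i = orbitOf α

  act-injective : ∀ p p' e → act p e ≡ act p' e → p ≡ p'
  act-injective []      []        e eq = refl
  act-injective []      (_ ∷ _)   e ()
  act-injective (_ ∷ _) []        e ()
  act-injective (α ∷ r) (α' ∷ r') e eq with perm-injective (head e) (Listₚ.∷-injectiveˡ eq)
  ... | refl = cong (α ∷_) (act-injective r r' (descend α e) (Listₚ.∷-injectiveʳ eq))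

  toggleIf-injective : ∀ i ε p p' → Reduced p → Reduced p' → toggleIf i ε p ≡ toggleIf i ε p' → p ≡ p'
  toggleIf-injective i false p p' _   _    eq = eq
  toggleIf-injective i true  p p' red red' eq =
    trans (sym (toggle-involutive i p red)) (trans (cong (toggle i) eq) (toggle-involutive i p' red'))

  actLetter-injective : ∀ p p' ℓ → Reduced p → Reduced p' → actLetter p ℓ ≡ actLetter p' ℓ → p ≡ p'
  actLetter-injective p p' (a x)   _   _    eq = act-injective p p' _ eq
  actLetter-injective p p' (b i x) red red' eq =
    act-injective p p' _ (toggleIf-injective i (flipsB i x) _ _
      (act-Reduced p _ (tupleB-InA i x) red) (act-Reduced p' _ (tupleB-InA i x) red') eq)

  actWord-injective : ∀ p p' w → Reduced p → Reduced p' → actWord p w ≡ actWord p' w → p ≡ p'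
  actWord-injective p p' []      _   _    eq = eq
  actWord-injective p p' (ℓ ∷ w) red red' eq =
    actLetter-injective p p' ℓ red red'
      (actWord-injective (actLetter p ℓ) (actLetter p' ℓ) w
        (actLetter-Reduced p ℓ red) (actLetter-Reduced p' ℓ red') eq)

  -- Detection: an element of A fixing every reduced sequence is trivial.
  -- Its entries all fix ω₁, and b₂ followed by b₁ rotates the tuple, so each
  -- coordinate of L_{ω₁}^n is in turn brought into the head position, where
  -- one-point sequences show it is the identity.

  Avoidsω₁ : Seq → Set
  Avoidsω₁ []      = ⊤
  Avoidsω₁ (β ∷ _) = ¬ (β ≡ ω zero)

  TrivialOffω₁ : Tuple → Set
  TrivialOffω₁ e = ∀ r → Reduced r → Avoidsω₁ r → act r e ≡ r

  head-trivial : ∀ e → TrivialOffω₁ e → Fixes zero (head e) → head e ≈ id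
  head-trivial e triv f β with β ≟ ω zero
  ... | yes refl = f
  ... | no ne    = Listₚ.∷-injectiveˡ (triv (β ∷ []) (tt , tt) ne)

  -- seen past the sequence ω₂ ω₁, an element with trivial head is rotated
  rotate-TrivialOffω₁ : ∀ e → TrivialOffω₁ e → head e ≈ id → TrivialOffω₁ (rotate {k = k'} e)
  rotate-TrivialOffω₁ e@(g ∷ v) triv gid r red avoids = begin
      act r (rotate {k = k'} e)
    ≡⟨ act-cong r (≋-sym (descend-rep zero (twist {k = k'} (suc zero) e) (gid _))) ⟩
      act r (descend (ω zero) (twist {k = k'} (suc zero) e))
    ≡⟨ Listₚ.∷-injectiveʳ (trans (act-cong (ω zero ∷ r) (≋-sym (descend-rep (suc zero) e (gid _))))
                                 (Listₚ.∷-injectiveʳ (triv (ω₂ ∷ ω zero ∷ r) reduced ω₂≢ω₁))) ⟩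
      r
    ∎
    where
    open ≡-Reasoning
    ω₂ : Fin m
    ω₂ = ω (suc zero)
    ω₂≢ω₁ : ¬ (ω₂ ≡ ω zero)
    ω₂≢ω₁ eq with rep-injective eq
    ... | ()
    reduced : Reduced (ω₂ ∷ ω zero ∷ r)
    reduced = (λ eq → ω₂≢ω₁ (sym (trans eq (cong ω (orbitOf-rep (suc zero))))))
            , mayFollow r avoids , red
      where
      mayFollow : ∀ r → Avoidsω₁ r → MayFollow (ω zero) r
      mayFollow []      _  = tt
      mayFollow (β ∷ _) ne = λ eq → ne (trans eq (cong ω (orbitOf-rep zero)))

  rotation-trivial : ∀ (xs ys : List (Perm m)) e → toList e ≡ xs ++ ys → TrivialOffω₁ e →
                     ListAll.All (Fixes zero) (toList e) → ListAll.All (_≈ id) xs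
  rotation-trivial []       ys e       _  _    _                     = ListAll.[]
  rotation-trivial (x ∷ xs) ys (g ∷ v) eq triv (f ListAll.∷ fs) =
    subst (_≈ id) (Listₚ.∷-injectiveˡ eq) gid ListAll.∷
      rotation-trivial xs (ys ++ x ∷ []) (rotate {k = k'} (g ∷ v)) rotated
        (rotate-TrivialOffω₁ (g ∷ v) triv gid)
        (subst (ListAll.All (Fixes zero)) (sym (toList-rotate {k = k'} g v)) (ListAllₚ.++⁺ fs (f ListAll.∷ ListAll.[])))
    where
    gid : g ≈ id
    gid = head-trivial (g ∷ v) triv f
    rotated : toList (rotate {k = k'} (g ∷ v)) ≡ xs ++ ys ++ x ∷ []
    rotated = begin
        toList (rotate {k = k'} (g ∷ v))
      ≡⟨ toList-rotate {k = k'} g v ⟩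
        toList v ++ g ∷ []
      ≡⟨ cong₂ (λ l z → l ++ z ∷ []) (Listₚ.∷-injectiveʳ eq) (Listₚ.∷-injectiveˡ eq) ⟩
        (xs ++ ys) ++ x ∷ []
      ≡⟨ Listₚ.++-assoc xs ys (x ∷ []) ⟩
        xs ++ ys ++ x ∷ []
      ∎ where open ≡-Reasoning

  perms-trivial : ∀ {k} (v : Pow k) → Trivial (perms v) → v ≈V 1V
  perms-trivial []      _        = []
  perms-trivial (_ ∷ v) (q ∷ qs) = q ∷ perms-trivial v qs

  A-detect : ∀ x → (∀ q → Reduced q → act q (tupleA x) ≡ q) → x ≈A 1A
  A-detect x@((g , _) , v) fixes-all = All.head entries , perms-trivial v (All.tail entries)
    where
    g-fixes : Fixes zero g
    g-fixes = Listₚ.∷-injectiveˡ (fixes-all (ω zero ∷ []) (tt , tt))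
    entries : Trivial (tupleA x)
    entries = Allₚ.toList⁻ (rotation-trivial (toList (tupleA x)) [] (tupleA x)
                (sym (Listₚ.++-identityʳ _)) (λ r red _ → fixes-all r red)
                (Allₚ.toList⁺ (g-fixes ∷ perms-fix v)))

  trivial-in-T : ∀ w x → w ~ (a x ∷ []) → (∀ q → Reduced q → actWord q w ≡ q) → w ~ []
  trivial-in-T w x w~x fixes =
    trans~ w~x (trans~ (rule (eqA-r x 1A (A-detect x x-fixes))) (rule oneA-r))
    where
    x-fixes : ∀ q → Reduced q → act q (tupleA x) ≡ q
    x-fixes q red = trans (sym (sound w~x q red)) (fixes q red)

  -- if w fixes every coset At, it fixes every reduced sequence [] · t
  faithful : FaithfulOnCosets
  faithful w fixes-cosets =
    trivial-in-T w (proj₁ (fixes-cosets [])) (proj₂ (fixes-cosets [])) w-fixes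
    where
    w-fixes : ∀ q → Reduced q → actWord q w ≡ q
    w-fixes q red with reach q red
    ... | t , refl with fixes-cosets t
    ... | x , tw~xt = trans (sym (actWord-++ [] t w)) (sound tw~xt [] tt)

  -- if w ∈ sAs⁻¹ where q · s = [], then q · w s = q · s, so q · w = q
  corefree : CoreFree
  corefree w in-conjugates =
    trivial-in-T w x (subst (_~ a x ∷ []) (Listₚ.++-identityʳ w) w~x) w-fixes
    where
    x : AElt
    x = proj₁ (in-conjugates [])
    w~x : (w ++ []) ~ (a x ∷ [])
    w~x = proj₂ (in-conjugates [])
    w-fixes : ∀ q → Reduced q → actWord q w ≡ q
    w-fixes q red with coreach q red
    ... | s , q↦[] with in-conjugates s
    ... | y , ws~sy = actWord-injective (actWord q w) q s (actWord-Reduced q w red) red (begin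
        actWord (actWord q w) s     ≡⟨ actWord-++ q w s ⟨
        actWord q (w ++ s)          ≡⟨ sound ws~sy q red ⟩
        actWord q (s ++ a y ∷ [])   ≡⟨ actWord-++ q s (a y ∷ []) ⟩
        act (actWord q s) (tupleA y) ≡⟨ cong (λ p → act p (tupleA y)) q↦[] ⟩
        []                          ≡⟨ q↦[] ⟨
        actWord q s                 ∎)
      where open ≡-Reasoning

-- Lemma 2.4.
lemma2p4 : (m : ℕ) (L : PermGroup m) → ¬ IsTransitive L → ¬ IsSemiregular L
           → (k' : ℕ) (ω : Fin (2 + k') → Fin m) → IsOrbitReps L ω
           → StabNontrivial L (ω zero)
           → (n : ℕ) → 2 ≤ n
           → Construction.CoreFree L k' ω n × Construction.FaithfulOnCosets L k' ω n
lemma2p4 m L _ _ k' ω reps _ n _ = CosetAction.corefree L k' ω reps n , CosetAction.faithful L k' ω reps n
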